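{- Let $v$ and $w$ be fully commutative permutations. (a) If $v$ is less than $w$ in the right weak order, then $\mathrm{Row}_2(P(v)) \subseteq \mathrm{Row}_2(P(w))$. (b) If $v$ is less than $w$ in the left weak order, then $\mathrm{Row}_2(Q(v)) \subseteq \mathrm{Row}_2(Q(w))$.
   Context: A permutation is fully commutative iff it avoids $321$. The right (resp. left) weak order on $S_n$ is the transitive closure of $w < ws_i$ (resp. $w<s_iw$) whenever the length increases, where $s_i$ swaps $i,i+1$. $P(w)$ and $Q(w)$ are the RSK insertion and recording tableaux of $w$, and $\mathrm{Row}_2(T)$ is the set of entries in the second row of a tableau $T$. -}

module Defs where

open import Data.Nat using (ℕ; zero; suc; _+_; _<_; _<ᵇ_; _≡ᵇ_)
open import Data.Bool using (Bool; true; false; if_then_else_)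
open import Data.List using (List; []; _∷_; _++_; [_]; map; upTo; length)
open import Data.Maybe using (Maybe; just; nothing)
open import Data.Product using (_×_; _,_; ∃; ∃-syntax; proj₁; proj₂)
open import Relation.Nullary using (¬_)
open import Relation.Binary.PropositionalEquality using (_≡_)
open import Data.List.Relation.Binary.Permutation.Propositional using (_↭_)
open import Data.List.Relation.Binary.Sublist.Propositional using (_⊆_)
open import Data.List.Membership.Propositional using (_∈_)
open import Relation.Binary.Construct.Closure.Transitive using (TransClosure)

-- Permutations of {1,…,n} in one-line notation: w = [w(1), …, w(n)].
IsPerm : ℕ → List ℕ → Set
IsPerm n w = w ↭ map suc (upTo n)

-- Fully commutative = 321-avoiding: no subsequence x, y, z with x > y > z.
Avoids321 : List ℕ → Set
Avoids321 w = ¬ (∃[ x ] ∃[ y ] ∃[ z ] ((x ∷ y ∷ z ∷ []) ⊆ w × y < x × z < y))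

-- Coxeter length = number of inversions.
countGreater : ℕ → List ℕ → ℕ
countGreater x [] = 0
countGreater x (y ∷ ys) = (if y <ᵇ x then 1 else 0) + countGreater x ys

inv : List ℕ → ℕ
inv [] = 0
inv (x ∷ xs) = countGreater x xs + inv xs

-- Right multiplication w ↦ w s_i (i ≥ 1): swap the entries in positions i, i+1.
swapPos : ℕ → List ℕ → List ℕ
swapPos zero xs = xs
swapPos (suc zero) (x ∷ y ∷ xs) = y ∷ x ∷ xs
swapPos (suc zero) xs = xs
swapPos (suc (suc i)) [] = []
swapPos (suc (suc i)) (x ∷ xs) = x ∷ swapPos (suc i) xs

sᵢ : ℕ → ℕ → ℕ
sᵢ i x = if x ≡ᵇ i then suc i else (if x ≡ᵇ suc i then i else x)

-- Left multiplication w ↦ s_i w (composition s_i ∘ w).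
leftMul : ℕ → List ℕ → List ℕ
leftMul i w = map (sᵢ i) w

RightCover : ℕ → List ℕ → List ℕ → Set
RightCover n v w = ∃[ i ] (1 Data.Nat.≤ i × i < n × w ≡ swapPos i v × inv v < inv w)

LeftCover : ℕ → List ℕ → List ℕ → Set
LeftCover n v w = ∃[ i ] (1 Data.Nat.≤ i × i < n × w ≡ leftMul i v × inv v < inv w)

RightWeakLt : ℕ → List ℕ → List ℕ → Set
RightWeakLt n = TransClosure (RightCover n)

LeftWeakLt : ℕ → List ℕ → List ℕ → Set
LeftWeakLt n = TransClosure (LeftCover n)

-- RSK (Schensted row insertion). Tableaux are lists of rows (top row first).
Tableau : Set
Tableau = List (List ℕ)

rowInsert : ℕ → List ℕ → List ℕ × Maybe ℕ
rowInsert x [] = [ x ] , nothing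
rowInsert x (y ∷ ys) with x <ᵇ y
... | true = x ∷ ys , just y
... | false with rowInsert x ys
... | ys' , b = y ∷ ys' , b

-- Insert into a tableau; also returns the (0-based) row where a box was added.
insert : ℕ → Tableau → Tableau × ℕ
insert x [] = [ [ x ] ] , 0
insert x (r ∷ rs) with rowInsert x r
... | r' , nothing = r' ∷ rs , 0
... | r' , just y with insert y rs
... | rs' , k = r' ∷ rs' , suc k

addAt : ℕ → ℕ → Tableau → Tableau
addAt zero k [] = [ [ k ] ]
addAt zero k (r ∷ rs) = (r ++ [ k ]) ∷ rs
addAt (suc i) k [] = []
addAt (suc i) k (r ∷ rs) = r ∷ addAt i k rs

rskFrom : ℕ → List ℕ → Tableau × Tableau → Tableau × Tableau
rskFrom k [] PQ = PQ
rskFrom k (x ∷ xs) (P , Q) with insert x P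
... | P' , i = rskFrom (suc k) xs (P' , addAt i k Q)

rsk : List ℕ → Tableau × Tableau
rsk w = rskFrom 1 w ([] , [])

Pt : List ℕ → Tableau
Pt w = proj₁ (rsk w)

Qt : List ℕ → Tableau
Qt w = proj₂ (rsk w)

Row₂ : Tableau → List ℕ
Row₂ (_ ∷ r ∷ _) = r
Row₂ _ = []

_⊆ₛ_ : List ℕ → List ℕ → Set
xs ⊆ₛ ys = ∀ x → x ∈ xs → x ∈ ys

-- If u avoids 321, Schensted insertion of u never bumps a letter out of the second row: a letter y bumped
-- out of the first row by x is appended to the second row, since an entry z > y there would, together with
-- y and x, witness a 321 pattern. So Row₂ (P u) consists of the letters bumped out of the first row, and
-- Row₂ (Q u) of the steps at which such a bump occurs.
-- A right cover v < v sᵢ exchanges adjacent letters a < b. Inserting b, a instead of a, b yields a first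
-- row contained in the one for v, and the containment survives the remaining insertions; since the second
-- row of P is the complement of the first, it can only grow.
-- A left cover v < sᵢ v has i before i + 1 in v. Up to the letter i + 1 both words are order-isomorphic and
-- bump at the same steps; from there on the first row for v stays contained, above i + 1, in the one for
-- sᵢ v, so sᵢ v bumps whenever v does.
-- 321-avoidance passes down and being a permutation passes up along each cover, so a chain of covers is
-- handled one cover at a time.

module Submission where

open import Defs
open import Data.Bool using (true; false; if_then_else_)
open import Data.Empty using (⊥; ⊥-elim)
open import Data.List using (List; []; _∷_; _++_; [_]; map; upTo; length; fromMaybe)
open import Data.List.Properties using (++-identityʳ; ++-assoc; map-++; length-map; map-id-local)
open import Data.List.Membership.Propositional using (_∈_; _∉_)
open import Data.List.Membership.Propositional.Properties
  using (∈-++⁺ˡ; ∈-++⁺ʳ; ∈-++⁻; ∈-insert; ∈-∃++; ∈-map⁺; ∈-map⁻; ∈-upTo⁺; ∈-upTo⁻)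
open import Data.List.Relation.Unary.Any using (here; there)
open import Data.List.Relation.Unary.All as All using (All; []; _∷_)
open import Data.List.Relation.Unary.AllPairs using (AllPairs; []; _∷_)
open import Data.List.Relation.Unary.Unique.Propositional using (Unique)
import Data.List.Relation.Unary.Unique.Propositional.Properties as Uniqueₚ
open Uniqueₚ using (Unique[x∷xs]⇒x∉xs)
open import Data.List.Relation.Binary.Disjoint.Propositional using (Disjoint)
open import Data.List.Relation.Binary.Sublist.Propositional
  using (_⊆_; []; _∷_; _∷ʳ_; from∈; to∈; minimum; ⊆-trans)
import Data.List.Relation.Binary.Sublist.Propositional.Properties as Sublist
open Sublist using (++⁺; ∷ˡ⁻)
open import Data.List.Relation.Binary.Permutation.Propositional using (_↭_; ↭-refl; ↭-swap; ↭-sym; ↭⇒↭ₛ)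
open import Data.List.Relation.Binary.Permutation.Propositional.Properties using (∈-resp-↭; ++⁺ˡ)
import Data.List.Relation.Binary.Permutation.Setoid.Properties as ↭ₛ
open import Data.Maybe using (Maybe; just; nothing)
import Data.Maybe as Maybe
open import Data.Nat using (ℕ; zero; suc; _+_; _<_; _≤_; _≮_; _<ᵇ_; _≡ᵇ_; z≤n; s≤s; s≤s⁻¹)
open import Data.Nat.Properties
open import Algebra.Properties.CommutativeSemigroup +-commutativeSemigroup using (x∙yz≈y∙xz)
open import Data.Product using (_×_; _,_; ∃-syntax; proj₁; proj₂; uncurry)
open import Data.Sum using (_⊎_; inj₁; inj₂; [_,_]′)
open import Function using (_∘_)
open import Relation.Nullary using (¬_)
open import Relation.Nullary.Reflects using (Reflects; ofʸ; ofⁿ; fromEquivalence; det)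
open import Relation.Binary.Construct.Closure.Transitive using (TransClosure) renaming ([_] to [_]⁺; _∷_ to _∷⁺_)
open import Relation.Binary.PropositionalEquality
  using (_≡_; _≢_; refl; sym; trans; cong; cong₂; subst; subst₂; module ≡-Reasoning)
open import Relation.Binary.PropositionalEquality.Properties using (setoid)

-- Row insertion

Increasing : List ℕ → Set
Increasing = AllPairs _<_

∈-++∷⁻ : ∀ {e m : ℕ} A {C} → e ∈ A ++ m ∷ C → e ∈ A ⊎ e ≡ m ⊎ e ∈ C
∈-++∷⁻ A p with ∈-++⁻ A p
... | inj₁ q = inj₁ q
... | inj₂ (here q) = inj₂ (inj₁ q)
... | inj₂ (there q) = inj₂ (inj₂ q)

∈-++∷⁺ʳ : ∀ {e m : ℕ} A {C} → e ∈ C → e ∈ A ++ m ∷ C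
∈-++∷⁺ʳ A p = ∈-++⁺ʳ A (there p)

increasing-++∷⇒<ˡ : ∀ {m} A {C} → Increasing (A ++ m ∷ C) → ∀ e → e ∈ A → e < m
increasing-++∷⇒<ˡ (a ∷ A) (a<* ∷ _) e (here refl) = All.lookup a<* (∈-insert A)
increasing-++∷⇒<ˡ (a ∷ A) (_ ∷ inc) e (there p) = increasing-++∷⇒<ˡ A inc e p

increasing-++∷⇒<ʳ : ∀ {m} A {C} → Increasing (A ++ m ∷ C) → ∀ e → e ∈ C → m < e
increasing-++∷⇒<ʳ [] (m<* ∷ _) e p = All.lookup m<* p
increasing-++∷⇒<ʳ (a ∷ A) (_ ∷ inc) e p = increasing-++∷⇒<ʳ A inc e p

increasing-++∷⁻ : ∀ {m} A {C} → Increasing (A ++ m ∷ C) → Increasing A × Increasing C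
increasing-++∷⁻ [] (_ ∷ incC) = [] , incC
increasing-++∷⁻ {m} (a ∷ A) {C} (a<* ∷ inc) =
  let incA , incC = increasing-++∷⁻ A inc in All.tabulate (λ p → All.lookup a<* (∈-++⁺ˡ p)) ∷ incA , incC

increasing-++∷⁺ : ∀ {m} A {C} → Increasing A → Increasing C →
  (∀ e → e ∈ A → e < m) → (∀ e → e ∈ C → m < e) → Increasing (A ++ m ∷ C)
increasing-++∷⁺ [] _ incC _ m<C = All.tabulate (m<C _) ∷ incC
increasing-++∷⁺ {m} (a ∷ A) {C} (a<A ∷ incA) incC A<m m<C =
  All.tabulate a< ∷ increasing-++∷⁺ A incA incC (λ e p → A<m e (there p)) m<C
  where
  a< : ∀ {e} → e ∈ A ++ m ∷ C → a < e
  a< p with ∈-++∷⁻ A p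
  ... | inj₁ q = All.lookup a<A q
  ... | inj₂ (inj₁ refl) = A<m a (here refl)
  ... | inj₂ (inj₂ q) = <-trans (A<m a (here refl)) (m<C _ q)

data RowInsertion (x : ℕ) (R : List ℕ) : List ℕ × Maybe ℕ → Set where
  appends : (∀ e → e ∈ R → x ≮ e) → RowInsertion x R (R ++ [ x ] , nothing)
  bumps : ∀ A y C → R ≡ A ++ y ∷ C → (∀ e → e ∈ A → x ≮ e) → x < y →
          RowInsertion x R (A ++ x ∷ C , just y)

rowInsert-view : ∀ x R → RowInsertion x R (rowInsert x R)
rowInsert-view x [] = appends (λ _ ())
rowInsert-view x (y ∷ ys) with x <ᵇ y | <ᵇ-reflects-< x y
... | true | ofʸ x<y = bumps [] y ys refl (λ _ ()) x<y
... | false | ofⁿ x≮y with rowInsert x ys | rowInsert-view x ys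
...   | _ | appends h = appends λ { e (here refl) → x≮y ; e (there p) → h e p }
...   | _ | bumps A z C refl h x<z =
          bumps (y ∷ A) z C refl (λ { e (here refl) → x≮y ; e (there p) → h e p }) x<z

rowInsert-≮ : ∀ {x R} → (∀ e → e ∈ R → x ≮ e) → rowInsert x R ≡ (R ++ [ x ] , nothing)
rowInsert-≮ {x} {R} x≮R with rowInsert x R | rowInsert-view x R
... | _ | appends _ = refl
... | _ | bumps A y C refl _ x<y = ⊥-elim (x≮R y (∈-insert A) x<y)

rowInsert-∈ : ∀ {x R r} → RowInsertion x R r → x ∈ proj₁ r
rowInsert-∈ (appends _) = ∈-++⁺ʳ _ (here refl)
rowInsert-∈ (bumps A _ _ _ _ _) = ∈-insert A

rowInsert-∈⁻ : ∀ {x R r e} → RowInsertion x R r → e ∈ proj₁ r → e ≡ x ⊎ e ∈ R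
rowInsert-∈⁻ {R = R} (appends _) p with ∈-++⁻ R p
... | inj₁ q = inj₂ q
... | inj₂ (here q) = inj₁ q
rowInsert-∈⁻ (bumps A y C refl _ _) p with ∈-++∷⁻ A p
... | inj₁ q = inj₂ (∈-++⁺ˡ q)
... | inj₂ (inj₁ q) = inj₁ q
... | inj₂ (inj₂ q) = inj₂ (∈-++∷⁺ʳ A q)

rowInsert-< : ∀ {x R r b} → RowInsertion x R r → x < b → (∀ e → e ∈ R → e < b) →
  ∀ e → e ∈ proj₁ r → e < b
rowInsert-< ins x<b R<b e p with rowInsert-∈⁻ ins p
... | inj₁ refl = x<b
... | inj₂ q = R<b e q

rowInsert-All : ∀ {P : ℕ → Set} {x R r} → RowInsertion x R r → P x → All P R → All P (proj₁ r)
rowInsert-All ins Px PR = All.tabulate λ p → [ (λ { refl → Px }) , All.lookup PR ]′ (rowInsert-∈⁻ ins p)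

rowInsert-increasing : ∀ {x R r} → RowInsertion x R r → Increasing R → x ∉ R → Increasing (proj₁ r)
rowInsert-increasing (appends h) incR x∉R =
  increasing-++∷⁺ _ incR [] (λ e p → ≤∧≢⇒< (≮⇒≥ (h e p)) λ { refl → x∉R p }) (λ _ ())
rowInsert-increasing (bumps A y C refl h x<y) incR x∉R =
  increasing-++∷⁺ A (proj₁ (increasing-++∷⁻ A incR)) (proj₂ (increasing-++∷⁻ A incR))
    (λ e p → ≤∧≢⇒< (≮⇒≥ (h e p)) λ { refl → x∉R (∈-++⁺ˡ p) })
    (λ e p → <-trans x<y (increasing-++∷⇒<ʳ A incR e p))

rowInsert-bumped-∈ : ∀ {x R r e} → RowInsertion x R r → e ∈ fromMaybe (proj₂ r) → e ∈ R
rowInsert-bumped-∈ (bumps A y C refl _ _) (here refl) = ∈-insert A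

rowInsert-bumped-∉ : ∀ {x R r e} → RowInsertion x R r → Increasing R →
  e ∈ fromMaybe (proj₂ r) → e ∉ proj₁ r
rowInsert-bumped-∉ (bumps A y C refl _ x<y) incR (here refl) p with ∈-++∷⁻ A p
... | inj₁ q = <-irrefl refl (increasing-++∷⇒<ˡ A incR _ q)
... | inj₂ (inj₁ refl) = <-irrefl refl x<y
... | inj₂ (inj₂ q) = <-irrefl refl (increasing-++∷⇒<ʳ A incR _ q)

rowInsert-bumped-> : ∀ {x R r b} → RowInsertion x R r → b ∈ fromMaybe (proj₂ r) → x < b
rowInsert-bumped-> (bumps _ _ _ _ _ x<y) (here refl) = x<y

rowInsert-bumped-≤ : ∀ {x R r b e} → RowInsertion x R r → Increasing R →
  b ∈ fromMaybe (proj₂ r) → e ∈ R → x < e → b ≤ e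
rowInsert-bumped-≤ (bumps A y C refl h _) incR (here refl) p x<e with ∈-++∷⁻ A p
... | inj₁ q = ⊥-elim (h _ q x<e)
... | inj₂ (inj₁ refl) = ≤-refl
... | inj₂ (inj₂ q) = <⇒≤ (increasing-++∷⇒<ʳ A incR _ q)

rowInsert-bumps : ∀ {x R r e} → RowInsertion x R r → e ∈ R → x < e → ∃[ y ] y ∈ fromMaybe (proj₂ r)
rowInsert-bumps (appends h) p x<e = ⊥-elim (h _ p x<e)
rowInsert-bumps (bumps _ y _ _ _ _) _ _ = y , here refl

-- The bumped entry only depends on the entries between the inserted letter and itself.
rowInsert-bumped-transfer : ∀ {x x′ R R′ r r′ e} → RowInsertion x R r → RowInsertion x′ R′ r′ →
  Increasing R → Increasing R′ → e ∈ fromMaybe (proj₂ r) → e ∈ R′ → x′ < e →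
  (∀ y → y ∈ R′ → x′ < y → y ≤ e → y ∈ R × x < y) → e ∈ fromMaybe (proj₂ r′)
rowInsert-bumped-transfer {r′ = r′} ins ins′ inc inc′ b e∈R′ x′<e between =
  subst (_∈ fromMaybe (proj₂ r′)) (≤-antisym y≤e e≤y) b′
  where
  y = proj₁ (rowInsert-bumps ins′ e∈R′ x′<e)
  b′ = proj₂ (rowInsert-bumps ins′ e∈R′ x′<e)
  y≤e = rowInsert-bumped-≤ ins′ inc′ b′ e∈R′ x′<e
  y∈R×x<y = between y (rowInsert-bumped-∈ ins′ b′) (rowInsert-bumped-> ins′ b′) y≤e
  e≤y = rowInsert-bumped-≤ ins inc b (proj₁ y∈R×x<y) (proj₂ y∈R×x<y)

rowInsert-nothing⇒≮ : ∀ {x R r} → RowInsertion x R r → proj₂ r ≡ nothing → ∀ e → e ∈ R → x ≮ e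
rowInsert-nothing⇒≮ (appends h) _ = h

rowInsert-≮⇒nothing : ∀ {x R r} → RowInsertion x R r → (∀ e → e ∈ R → x ≮ e) → proj₂ r ≡ nothing
rowInsert-≮⇒nothing (appends _) _ = refl
rowInsert-≮⇒nothing (bumps A y C refl _ x<y) h = ⊥-elim (h y (∈-insert A) x<y)

rowInsert-∪⁻ : ∀ {x R r u e} → RowInsertion x R r → e ∈ proj₁ r ⊎ e ∈ u → e ∈ R ⊎ e ∈ x ∷ u
rowInsert-∪⁻ ins (inj₂ q) = inj₂ (there q)
rowInsert-∪⁻ ins (inj₁ p) with rowInsert-∈⁻ ins p
... | inj₁ refl = inj₂ (here refl)
... | inj₂ q = inj₁ q

rowInsert-∪⁺ : ∀ {x R r u e} → RowInsertion x R r → e ∈ R ⊎ e ∈ x ∷ u →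
  e ∈ fromMaybe (proj₂ r) ⊎ e ∈ proj₁ r ⊎ e ∈ u
rowInsert-∪⁺ ins (inj₂ (there q)) = inj₂ (inj₂ q)
rowInsert-∪⁺ ins (inj₂ (here refl)) = inj₂ (inj₁ (rowInsert-∈ ins))
rowInsert-∪⁺ (appends _) (inj₁ p) = inj₂ (inj₁ (∈-++⁺ˡ p))
rowInsert-∪⁺ (bumps A y C refl _ _) (inj₁ p) with ∈-++∷⁻ A p
... | inj₁ q = inj₂ (inj₁ (∈-++⁺ˡ q))
... | inj₂ (inj₁ refl) = inj₁ (here refl)
... | inj₂ (inj₂ q) = inj₂ (inj₁ (∈-++∷⁺ʳ A q))

rowInsertAll : List ℕ → List ℕ → List ℕ
rowInsertAll [] R = R
rowInsertAll (x ∷ u) R = rowInsertAll u (proj₁ (rowInsert x R))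

bumpedOut : List ℕ → List ℕ → List ℕ
bumpedOut [] R = []
bumpedOut (x ∷ u) R = fromMaybe (proj₂ (rowInsert x R)) ++ bumpedOut u (proj₁ (rowInsert x R))

markIfJust : ℕ → Maybe ℕ → List ℕ
markIfJust k b = fromMaybe (Maybe.map (λ _ → k) b)

bumpTimes : ℕ → List ℕ → List ℕ → List ℕ
bumpTimes k [] R = []
bumpTimes k (x ∷ u) R =
  markIfJust k (proj₂ (rowInsert x R)) ++ bumpTimes (suc k) u (proj₁ (rowInsert x R))

rowInsertAll-++ : ∀ p {q} R → rowInsertAll (p ++ q) R ≡ rowInsertAll q (rowInsertAll p R)
rowInsertAll-++ [] R = refl
rowInsertAll-++ (x ∷ p) R = rowInsertAll-++ p (proj₁ (rowInsert x R))

bumpTimes-++ : ∀ k p {q} R →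
  bumpTimes k (p ++ q) R ≡ bumpTimes k p R ++ bumpTimes (k + length p) q (rowInsertAll p R)
bumpTimes-++ k [] {q} R = cong (λ k′ → bumpTimes k′ q R) (sym (+-identityʳ k))
bumpTimes-++ k (x ∷ p) {q} R
  rewrite bumpTimes-++ (suc k) p {q} (proj₁ (rowInsert x R)) | +-suc k (length p) =
  sym (++-assoc (markIfJust k (proj₂ (rowInsert x R))) _ _)

record Admissible (R u : List ℕ) : Set where
  field
    increasing : Increasing R
    disjoint : Disjoint R u
    unique : Unique u
open Admissible

admissible-[] : ∀ {u} → Unique u → Admissible [] u
admissible-[] uniq = record { increasing = [] ; disjoint = λ { (() , _) } ; unique = uniq }

admissible-resp-↭ : ∀ {R u v} → u ↭ v → Admissible R u → Admissible R v
admissible-resp-↭ u↭v adm = record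
  { increasing = increasing adm
  ; disjoint = λ { (p , q) → disjoint adm (p , ∈-resp-↭ (↭-sym u↭v) q) }
  ; unique = ↭ₛ.Unique-resp-↭ (setoid ℕ) (↭⇒↭ₛ u↭v) (unique adm) }

rowInsert-admissible : ∀ {x R r u} → RowInsertion x R r → Admissible R (x ∷ u) → Admissible (proj₁ r) u
rowInsert-admissible {x} {R} {r} {u} ins adm = record
  { increasing = rowInsert-increasing ins (increasing adm) (λ p → disjoint adm (p , here refl))
  ; disjoint = λ { (p , q) → fresh p q }
  ; unique = tail (unique adm) }
  where
  tail : Unique (x ∷ u) → Unique u
  tail (_ ∷ uniq) = uniq
  fresh : ∀ {e} → e ∈ proj₁ r → e ∉ u
  fresh p q with rowInsert-∈⁻ ins p
  ... | inj₁ refl = Unique[x∷xs]⇒x∉xs (unique adm) q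
  ... | inj₂ p′ = disjoint adm (p′ , there q)

rowInsertAll-admissible : ∀ u {v} R → Admissible R (u ++ v) → Admissible (rowInsertAll u R) v
rowInsertAll-admissible [] R adm = adm
rowInsertAll-admissible (x ∷ u) R adm =
  rowInsertAll-admissible u _ (rowInsert-admissible (rowInsert-view x R) adm)

rowInsertAll-∈⁻ : ∀ u R {e} → e ∈ rowInsertAll u R → e ∈ R ⊎ e ∈ u
rowInsertAll-∈⁻ [] R p = inj₁ p
rowInsertAll-∈⁻ (x ∷ u) R p = rowInsert-∪⁻ (rowInsert-view x R) (rowInsertAll-∈⁻ u _ p)

bumpedOut-∈⁻ : ∀ u R {e} → e ∈ bumpedOut u R → e ∈ R ⊎ e ∈ u
bumpedOut-∈⁻ (x ∷ u) R p with ∈-++⁻ (fromMaybe (proj₂ (rowInsert x R))) p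
... | inj₁ q = inj₁ (rowInsert-bumped-∈ (rowInsert-view x R) q)
... | inj₂ q = rowInsert-∪⁻ (rowInsert-view x R) (bumpedOut-∈⁻ u _ q)

rowInsertAll-∪-bumpedOut : ∀ u R {e} → e ∈ R ⊎ e ∈ u → e ∈ rowInsertAll u R ⊎ e ∈ bumpedOut u R
rowInsertAll-∪-bumpedOut [] R (inj₁ p) = inj₁ p
rowInsertAll-∪-bumpedOut (x ∷ u) R m with rowInsert-∪⁺ (rowInsert-view x R) m
... | inj₁ q = inj₂ (∈-++⁺ˡ q)
... | inj₂ m′ with rowInsertAll-∪-bumpedOut u _ m′
...   | inj₁ q = inj₁ q
...   | inj₂ q = inj₂ (∈-++⁺ʳ _ q)

bumpedOut-disjoint : ∀ u R → Admissible R u → Disjoint (bumpedOut u R) (rowInsertAll u R)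
bumpedOut-disjoint (x ∷ u) R adm (p , q) with ∈-++⁻ (fromMaybe (proj₂ (rowInsert x R))) p
... | inj₂ p′ = bumpedOut-disjoint u _ (rowInsert-admissible (rowInsert-view x R) adm) (p′ , q)
... | inj₁ b with rowInsertAll-∈⁻ u _ q
...   | inj₁ q′ = rowInsert-bumped-∉ (rowInsert-view x R) (increasing adm) b q′
...   | inj₂ q′ = disjoint adm (rowInsert-bumped-∈ (rowInsert-view x R) b , there q′)

-- Two-row tableaux of 321-avoiding words

avoids321-∷⁻ : ∀ {x u} → Avoids321 (x ∷ u) → Avoids321 u
avoids321-∷⁻ {x} avoids (a , b , c , p , b<a , c<b) = avoids (a , b , c , x ∷ʳ p , b<a , c<b)

Avoids321From : List ℕ → List ℕ → Set
Avoids321From S u = ∀ d → d ∈ S → ∀ c x → (c ∷ x ∷ []) ⊆ u → c < d → x < c → ⊥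

Avoids321Across : List ℕ → List ℕ → List ℕ → Set
Avoids321Across B R u = ∀ z → z ∈ B → ∀ e → e ∈ R → e < z → ∀ x → x ∈ u → x < e → ⊥

avoids321From-∷⁻ : ∀ {S x u} → Avoids321From S (x ∷ u) → Avoids321From S u
avoids321From-∷⁻ {x = x} avoids d p c y q = avoids d p c y (x ∷ʳ q)

avoids321-head : ∀ {x u} → Avoids321 (x ∷ u) → Avoids321From [ x ] u
avoids321-head {x} avoids .x (here refl) c y p c<x y<c = avoids (x , c , y , refl ∷ p , c<x , y<c)

rowInsert-avoids321From : ∀ {x R r u} → RowInsertion x R r → Avoids321 (x ∷ u) →
  Avoids321From R (x ∷ u) → Avoids321From (proj₁ r) u
rowInsert-avoids321From ins avoids avoidsR d p with rowInsert-∈⁻ ins p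
... | inj₁ refl = avoids321-head avoids d (here refl)
... | inj₂ q = avoids321From-∷⁻ avoidsR d q

rowInsert-avoids321Across : ∀ {x R r u B} → RowInsertion x R r → Avoids321From B (x ∷ u) →
  Avoids321Across B R (x ∷ u) → Avoids321Across B (proj₁ r) u
rowInsert-avoids321Across ins avoidsB across z zB e p e<z y yu y<e with rowInsert-∈⁻ ins p
... | inj₁ refl = avoidsB z zB e y (refl ∷ from∈ yu) e<z y<e
... | inj₂ q = across z zB e q e<z y (there yu) y<e

record TwoRowInvariant (R B u : List ℕ) : Set where
  field
    admissible : Admissible R u
    avoids : Avoids321 u
    firstRow-avoids : Avoids321From R u
    secondRow-avoids : Avoids321From B u
    across-avoids : Avoids321Across B R u
open TwoRowInvariant

twoRowInvariant-empty : ∀ {u} → Unique u → Avoids321 u → TwoRowInvariant [] [] u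
twoRowInvariant-empty uniq avoids = record
  { admissible = admissible-[] uniq
  ; avoids = avoids
  ; firstRow-avoids = λ _ ()
  ; secondRow-avoids = λ _ ()
  ; across-avoids = λ _ () }

twoRow-keep : ∀ {x R r B u} → RowInsertion x R r →
  TwoRowInvariant R B (x ∷ u) → TwoRowInvariant (proj₁ r) B u
twoRow-keep ins I = record
  { admissible = rowInsert-admissible ins (admissible I)
  ; avoids = avoids321-∷⁻ (avoids I)
  ; firstRow-avoids = rowInsert-avoids321From ins (avoids I) (firstRow-avoids I)
  ; secondRow-avoids = avoids321From-∷⁻ (secondRow-avoids I)
  ; across-avoids = rowInsert-avoids321Across ins (secondRow-avoids I) (across-avoids I) }

bumped-exceeds-secondRow : ∀ {A y C B x u} → TwoRowInvariant (A ++ y ∷ C) B (x ∷ u) → x < y →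
  ∀ z → z ∈ B → y ≮ z
bumped-exceeds-secondRow {A} I x<y z zB y<z = across-avoids I z zB _ (∈-insert A) y<z _ (here refl) x<y

twoRow-bumps : ∀ {A y C B x u} → TwoRowInvariant (A ++ y ∷ C) B (x ∷ u) →
  (∀ e → e ∈ A → x ≮ e) → x < y → TwoRowInvariant (A ++ x ∷ C) (B ++ [ y ]) u
twoRow-bumps {A} {y} {C} {B} {x} {u} I h x<y = record
  { admissible = admissible keep
  ; avoids = avoids keep
  ; firstRow-avoids = firstRow-avoids keep
  ; secondRow-avoids = secondRow′
  ; across-avoids = across′ }
  where
  ins : RowInsertion x (A ++ y ∷ C) (A ++ x ∷ C , just y)
  ins = bumps A y C refl h x<y
  keep : TwoRowInvariant (A ++ x ∷ C) B u
  keep = twoRow-keep ins I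
  y-avoids : Avoids321From [ y ] (x ∷ u)
  y-avoids .y (here refl) = firstRow-avoids I y (∈-insert A)
  secondRow′ : Avoids321From (B ++ [ y ]) u
  secondRow′ d p with ∈-++⁻ B p
  ... | inj₁ q = avoids321From-∷⁻ (secondRow-avoids I) d q
  ... | inj₂ q = avoids321From-∷⁻ y-avoids d q
  across′ : Avoids321Across (B ++ [ y ]) (A ++ x ∷ C) u
  across′ z p with ∈-++⁻ B p
  ... | inj₁ q = rowInsert-avoids321Across ins (secondRow-avoids I) (across-avoids I) z q
  across′ z p | inj₂ (here refl) = λ e q e<y w wu w<e →
    y-avoids y (here refl) x w (refl ∷ from∈ wu) x<y (w<x e q e<y w<e)
    where
    w<x : ∀ e → e ∈ A ++ x ∷ C → e < y → ∀ {w} → w < e → w < x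
    w<x e q e<y w<e with ∈-++∷⁻ A q
    ... | inj₁ e∈A = <-≤-trans w<e (≮⇒≥ (h e e∈A))
    ... | inj₂ (inj₁ refl) = w<e
    ... | inj₂ (inj₂ e∈C) =
      ⊥-elim (<-asym e<y (increasing-++∷⇒<ʳ A (increasing (admissible I)) e e∈C))

nonemptyRow : List ℕ → Tableau
nonemptyRow [] = []
nonemptyRow (b ∷ bs) = [ b ∷ bs ]

twoRow : List ℕ → List ℕ → Tableau
twoRow R B = R ∷ nonemptyRow B

Row₂-twoRow : ∀ R B → Row₂ (twoRow R B) ≡ B
Row₂-twoRow R [] = refl
Row₂-twoRow R (_ ∷ _) = refl

addAt-nonemptyRow : ∀ k B → addAt 0 k (nonemptyRow B) ≡ nonemptyRow (B ++ [ k ])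
addAt-nonemptyRow k [] = refl
addAt-nonemptyRow k (_ ∷ _) = refl

insert-nonemptyRow : ∀ y B → (∀ z → z ∈ B → y ≮ z) →
  insert y (nonemptyRow B) ≡ (nonemptyRow (B ++ [ y ]) , 0)
insert-nonemptyRow y [] h = refl
insert-nonemptyRow y (b ∷ bs) h rewrite rowInsert-≮ {y} {b ∷ bs} h = refl

rskFrom-twoRow : ∀ k u R B Q₁ Q₂ → TwoRowInvariant R B u →
  ∃[ Q₁′ ] rskFrom k u (twoRow R B , twoRow Q₁ Q₂)
           ≡ (twoRow (rowInsertAll u R) (B ++ bumpedOut u R) , twoRow Q₁′ (Q₂ ++ bumpTimes k u R))
rskFrom-twoRow k [] R B Q₁ Q₂ I rewrite ++-identityʳ B | ++-identityʳ Q₂ = Q₁ , refl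
rskFrom-twoRow k (x ∷ u) R B Q₁ Q₂ I with rowInsert x R | rowInsert-view x R
... | _ | appends h = rskFrom-twoRow (suc k) u (R ++ [ x ]) B (Q₁ ++ [ k ]) Q₂ (twoRow-keep (appends h) I)
... | _ | bumps A y C refl h x<y
    rewrite insert-nonemptyRow y B (bumped-exceeds-secondRow I x<y) | addAt-nonemptyRow k Q₂
          | sym (++-assoc B [ y ] (bumpedOut u (A ++ x ∷ C)))
          | sym (++-assoc Q₂ [ k ] (bumpTimes (suc k) u (A ++ x ∷ C)))
    = rskFrom-twoRow (suc k) u (A ++ x ∷ C) (B ++ [ y ]) Q₁ (Q₂ ++ [ k ]) (twoRow-bumps I h x<y)

Row₂-rsk : ∀ u → Unique u → Avoids321 u →
  Row₂ (Pt u) ≡ bumpedOut u [] × Row₂ (Qt u) ≡ bumpTimes 1 u []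
Row₂-rsk [] _ _ = refl , refl
Row₂-rsk (x ∷ u) uniq avoids
  with rskFrom-twoRow 2 u [ x ] [] [ 1 ] []
         (twoRow-keep (rowInsert-view x []) (twoRowInvariant-empty uniq avoids))
... | _ , eq rewrite eq = Row₂-twoRow _ _ , Row₂-twoRow _ _

-- Comparing first rows

infix 4 _⊆ₛ_above_

_⊆ₛ_above_ : List ℕ → List ℕ → ℕ → Set
Rv ⊆ₛ Rw above t = ∀ e → e ∈ Rv → t < e → e ∈ Rw

⊆ₛ-above-trans : ∀ {a b c t} → a ⊆ₛ b above t → b ⊆ₛ c above t → a ⊆ₛ c above t
⊆ₛ-above-trans a⊆b b⊆c e p t<e = b⊆c e (a⊆b e p t<e) t<e

rowInsert-⊆above : ∀ {t xv xw Rv Rw rv rw} → RowInsertion xv Rv rv → RowInsertion xw Rw rw →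
  Increasing Rv → Increasing Rw → t ≤ xv → xw ≤ xv → xv ≡ xw ⊎ xv ≡ t → Rv ⊆ₛ Rw above t →
  proj₁ rv ⊆ₛ proj₁ rw above t × (proj₂ rw ≡ nothing → proj₂ rv ≡ nothing)
rowInsert-⊆above {t} {xv} {xw} {Rv} {Rw} {rv} {rw} insv insw incv incw t≤xv xw≤xv same⊎threshold rel =
  included , bumpsAlso
  where
  xw<⇒xv< : ∀ {e} → t < e → xw < e → xv < e
  xw<⇒xv< {e} t<e xw<e =
    [ (λ xv≡xw → subst (_< e) (sym xv≡xw) xw<e) , (λ xv≡t → subst (_< e) (sym xv≡t) t<e) ]′ same⊎threshold
  bumpsAlso : proj₂ rw ≡ nothing → proj₂ rv ≡ nothing
  bumpsAlso w-appends = rowInsert-≮⇒nothing insv λ e p xv<e →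
    rowInsert-nothing⇒≮ insw w-appends e (rel e p (≤-<-trans t≤xv xv<e)) (≤-<-trans xw≤xv xv<e)
  survives : ∀ e → e ∈ Rv → t < e → e ∉ fromMaybe (proj₂ rv) → e ∈ proj₁ rw
  survives e p t<e e∉bv with rowInsert-∪⁺ {u = []} insw (inj₁ (rel e p t<e))
  ... | inj₂ (inj₁ q) = q
  ... | inj₁ bw = ⊥-elim (e∉bv (rowInsert-bumped-transfer insw insv incw incv bw p
                                  (xw<⇒xv< t<e (rowInsert-bumped-> insw bw)) between))
    where
    between : ∀ y → y ∈ Rv → xv < y → y ≤ e → y ∈ Rw × xw < y
    between y q xv<y _ = rel y q (≤-<-trans t≤xv xv<y) , ≤-<-trans xw≤xv xv<y
  included : proj₁ rv ⊆ₛ proj₁ rw above t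
  included e p t<e with rowInsert-∈⁻ insv p
  ... | inj₂ q = survives e q t<e (λ b → rowInsert-bumped-∉ insv incv b p)
  ... | inj₁ e≡xv =
    [ (λ xv≡xw → subst (_∈ proj₁ rw) (sym (trans e≡xv xv≡xw)) (rowInsert-∈ insw))
    , (λ xv≡t → ⊥-elim (<-irrefl (sym (trans e≡xv xv≡t)) t<e)) ]′ same⊎threshold

markIfJust-⊆ : ∀ k {bv bw : Maybe ℕ} {l l′} → (bw ≡ nothing → bv ≡ nothing) → l ⊆ₛ l′ →
  (markIfJust k bv ++ l) ⊆ₛ (markIfJust k bw ++ l′)
markIfJust-⊆ k {nothing} {nothing} _ l⊆l′ = l⊆l′
markIfJust-⊆ k {nothing} {just _} _ l⊆l′ j p = there (l⊆l′ j p)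
markIfJust-⊆ k {just _} {nothing} bumpsAlso with bumpsAlso refl
... | ()
markIfJust-⊆ k {just _} {just _} _ l⊆l′ j (here refl) = here refl
markIfJust-⊆ k {just _} {just _} _ l⊆l′ j (there p) = there (l⊆l′ j p)

rowInsertAll-⊆above : ∀ t k C Rv Rw → Admissible Rv C → Admissible Rw C → All (t <_) C →
  Rv ⊆ₛ Rw above t →
  (bumpTimes k C Rv ⊆ₛ bumpTimes k C Rw) × (rowInsertAll C Rv ⊆ₛ rowInsertAll C Rw above t)
rowInsertAll-⊆above t k [] Rv Rw _ _ _ rel = (λ _ p → p) , rel
rowInsertAll-⊆above t k (x ∷ C) Rv Rw admv admw (t<x ∷ t<C) rel =
  markIfJust-⊆ k (proj₂ step) (proj₁ rest) , proj₂ rest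
  where
  insv = rowInsert-view x Rv
  insw = rowInsert-view x Rw
  step = rowInsert-⊆above insv insw (increasing admv) (increasing admw) (<⇒≤ t<x) ≤-refl (inj₁ refl) rel
  rest = rowInsertAll-⊆above t (suc k) C _ _ (rowInsert-admissible insv admv) (rowInsert-admissible insw admw)
           t<C (proj₁ step)

record Enumerates (n : ℕ) (u : List ℕ) : Set where
  field
    distinct : Unique u
    bounded : ∀ x → x ∈ u → 1 ≤ x × x ≤ n
    complete : ∀ x → 1 ≤ x → x ≤ n → x ∈ u
open Enumerates

enumerates-resp-↭ : ∀ {n u v} → u ↭ v → Enumerates n u → Enumerates n v
enumerates-resp-↭ u↭v en = record
  { distinct = ↭ₛ.Unique-resp-↭ (setoid ℕ) (↭⇒↭ₛ u↭v) (distinct en)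
  ; bounded = λ x p → bounded en x (∈-resp-↭ (↭-sym u↭v) p)
  ; complete = λ x 1≤x x≤n → ∈-resp-↭ u↭v (complete en x 1≤x x≤n) }

isPerm⇒enumerates : ∀ {n u} → IsPerm n u → Enumerates n u
isPerm⇒enumerates {n} u↭ = enumerates-resp-↭ (↭-sym u↭) record
  { distinct = Uniqueₚ.map⁺ suc-injective (Uniqueₚ.upTo⁺ n)
  ; bounded = bounded′
  ; complete = λ { (suc x) _ x<n → ∈-map⁺ suc (∈-upTo⁺ x<n) } }
  where
  bounded′ : ∀ x → x ∈ map suc (upTo n) → 1 ≤ x × x ≤ n
  bounded′ x p with ∈-map⁻ suc p
  ... | y , q , refl = s≤s z≤n , ∈-upTo⁻ q

bumpedOut-mono : ∀ {n} v w → Enumerates n v → Enumerates n w →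
  rowInsertAll w [] ⊆ₛ rowInsertAll v [] above 0 → bumpedOut v [] ⊆ₛ bumpedOut w []
bumpedOut-mono v w env enw rel x p with bumpedOut-∈⁻ v [] p
... | inj₂ x∈v with bounded env x x∈v
...   | 1≤x , x≤n with rowInsertAll-∪-bumpedOut w [] (inj₂ (complete enw x 1≤x x≤n))
...     | inj₂ q = q
...     | inj₁ q = ⊥-elim (bumpedOut-disjoint v [] (admissible-[] (distinct env)) (p , rel x q 1≤x))

-- Right covers

rowInsert-∷ʳ-larger : ∀ {x b R r rb} → RowInsertion x R r → RowInsertion x (R ++ [ b ]) rb →
  Increasing R → (∀ e → e ∈ R → e < b) → proj₁ rb ⊆ₛ (proj₁ r ++ [ b ])
rowInsert-∷ʳ-larger {x} {b} {R} ins insb incR R<b e p with rowInsert-∈⁻ insb p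
... | inj₁ refl = ∈-++⁺ˡ (rowInsert-∈ ins)
... | inj₂ q with ∈-++⁻ R q
...   | inj₂ (here refl) = ∈-++⁺ʳ _ (here refl)
...   | inj₁ e∈R with rowInsert-∪⁺ {u = []} ins (inj₁ e∈R)
...     | inj₂ (inj₁ q′) = ∈-++⁺ˡ q′
...     | inj₁ bumped = ⊥-elim (rowInsert-bumped-∉ insb incb bumpedb p)
  where
  incb : Increasing (R ++ [ b ])
  incb = increasing-++∷⁺ R incR [] R<b (λ _ ())
  between : ∀ y → y ∈ R ++ [ b ] → x < y → y ≤ e → y ∈ R × x < y
  between y q x<y y≤e with ∈-++⁻ R q
  ... | inj₁ y∈R = y∈R , x<y
  ... | inj₂ (here refl) = ⊥-elim (<⇒≱ (R<b e e∈R) y≤e)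
  bumpedb = rowInsert-bumped-transfer ins insb incR incb bumped q (rowInsert-bumped-> ins bumped) between

-- b is appended in either order, and a bumps the same entry of R in both, unless it bumps b itself.
rowInsertAll-swap-⊆ : ∀ {a b} R → Increasing R → (∀ e → e ∈ R → e < b) → a < b →
  rowInsertAll (b ∷ a ∷ []) R ⊆ₛ rowInsertAll (a ∷ b ∷ []) R
rowInsertAll-swap-⊆ {a} {b} R incR R<b a<b
  rewrite rowInsert-≮ {b} {R} (λ e p → <⇒≯ (R<b e p))
        | rowInsert-≮ {b} {proj₁ (rowInsert a R)}
                      (λ e p → <⇒≯ (rowInsert-< (rowInsert-view a R) a<b R<b e p)) =
  rowInsert-∷ʳ-larger (rowInsert-view a R) (rowInsert-view a (R ++ [ b ])) incR R<b

rowInsertAll-swap-adjacent : ∀ pre {a b} suf → a < b → Unique (pre ++ a ∷ b ∷ suf) →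
  Avoids321 (pre ++ b ∷ a ∷ suf) → All (0 <_) suf →
  rowInsertAll (pre ++ b ∷ a ∷ suf) [] ⊆ₛ rowInsertAll (pre ++ a ∷ b ∷ suf) [] above 0
rowInsertAll-swap-adjacent pre {a} {b} suf a<b uniq avoids pos
  rewrite rowInsertAll-++ pre {b ∷ a ∷ suf} [] | rowInsertAll-++ pre {a ∷ b ∷ suf} [] =
  proj₂ (rowInsertAll-⊆above 0 1 suf _ _ (rowInsertAll-admissible (b ∷ a ∷ []) R admba)
           (rowInsertAll-admissible (a ∷ b ∷ []) R admab) pos
           (λ e p _ → rowInsertAll-swap-⊆ R (increasing admab) R<b a<b e p))
  where
  R = rowInsertAll pre []
  admab : Admissible R (a ∷ b ∷ suf)
  admab = rowInsertAll-admissible pre [] (admissible-[] uniq)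
  admba : Admissible R (b ∷ a ∷ suf)
  admba = admissible-resp-↭ (↭-swap a b ↭-refl) admab
  -- An entry e > b of R comes from pre, and e, b, a would be a 321 pattern.
  R<b : ∀ e → e ∈ R → e < b
  R<b e p with rowInsertAll-∈⁻ pre [] p
  ... | inj₂ e∈pre = ≤∧≢⇒< (≮⇒≥ e≯b) (λ { refl → disjoint admab (p , there (here refl)) })
    where
    e≯b : b ≮ e
    e≯b b<e = avoids (e , b , a , ++⁺ (from∈ e∈pre) (refl ∷ refl ∷ minimum suf) , b<e , a<b)

swapPos-cases : ∀ i v → swapPos i v ≡ v ⊎
  ∃[ pre ] ∃[ a ] ∃[ b ] ∃[ suf ] (v ≡ pre ++ a ∷ b ∷ suf × swapPos i v ≡ pre ++ b ∷ a ∷ suf)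
swapPos-cases zero v = inj₁ refl
swapPos-cases (suc zero) [] = inj₁ refl
swapPos-cases (suc zero) (x ∷ []) = inj₁ refl
swapPos-cases (suc zero) (x ∷ y ∷ v) = inj₂ ([] , x , y , v , refl , refl)
swapPos-cases (suc (suc i)) [] = inj₁ refl
swapPos-cases (suc (suc i)) (x ∷ v) with swapPos-cases (suc i) v
... | inj₁ eq = inj₁ (cong (x ∷_) eq)
... | inj₂ (pre , a , b , suf , eq₁ , eq₂) =
  inj₂ (x ∷ pre , a , b , suf , cong (x ∷_) eq₁ , cong (x ∷_) eq₂)

countGreater-swap : ∀ p pre a b suf →
  countGreater p (pre ++ a ∷ b ∷ suf) ≡ countGreater p (pre ++ b ∷ a ∷ suf)
countGreater-swap p [] a b suf =
  x∙yz≈y∙xz (if a <ᵇ p then 1 else 0) (if b <ᵇ p then 1 else 0) (countGreater p suf)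
countGreater-swap p (x ∷ pre) a b suf = cong (_ +_) (countGreater-swap p pre a b suf)

inv-swap⇒< : ∀ pre a b suf → inv (pre ++ a ∷ b ∷ suf) < inv (pre ++ b ∷ a ∷ suf) → a < b
inv-swap⇒< (p ∷ pre) a b suf lt rewrite countGreater-swap p pre a b suf =
  inv-swap⇒< pre a b suf (+-cancelˡ-< _ _ _ lt)
inv-swap⇒< [] a b suf lt with a <ᵇ b | <ᵇ-reflects-< a b
... | true | ofʸ a<b = a<b
... | false | ofⁿ _ = ⊥-elim (<⇒≱ lt (begin
    B + (A + I)                 ≡⟨ x∙yz≈y∙xz A B I ⟨
    A + (B + I)                 ≤⟨ m≤n+m _ X ⟩
    X + (A + (B + I))           ≡⟨ +-assoc X A (B + I) ⟨
    X + A + (B + I)             ∎))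
  where
  open ≤-Reasoning
  A = countGreater a suf
  B = countGreater b suf
  I = inv suf
  X = if b <ᵇ a then 1 else 0

⊆-swap : ∀ pre (a b : ℕ) suf {xs} → xs ⊆ pre ++ a ∷ b ∷ suf →
  xs ⊆ pre ++ b ∷ a ∷ suf ⊎ ∃[ ys ] ∃[ zs ] xs ≡ ys ++ a ∷ b ∷ zs
⊆-swap [] a b suf (.a ∷ʳ (.b ∷ʳ p)) = inj₁ (b ∷ʳ (a ∷ʳ p))
⊆-swap [] a b suf (.a ∷ʳ (refl ∷ p)) = inj₁ (refl ∷ (a ∷ʳ p))
⊆-swap [] a b suf (refl ∷ (.b ∷ʳ p)) = inj₁ (b ∷ʳ (refl ∷ p))
⊆-swap [] a b suf {_ ∷ _ ∷ zs} (refl ∷ (refl ∷ p)) = inj₂ ([] , zs , refl)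
⊆-swap (q ∷ pre) a b suf (.q ∷ʳ p) with ⊆-swap pre a b suf p
... | inj₁ r = inj₁ (q ∷ʳ r)
... | inj₂ r = inj₂ r
⊆-swap (q ∷ pre) a b suf (refl ∷ p) with ⊆-swap pre a b suf p
... | inj₁ r = inj₁ (refl ∷ r)
... | inj₂ (ys , zs , refl) = inj₂ (q ∷ ys , zs , refl)

-- Only a pattern using both a and b can be lost, and it would need a > b.
avoids321-unswap : ∀ pre {a b} suf → a < b →
  Avoids321 (pre ++ b ∷ a ∷ suf) → Avoids321 (pre ++ a ∷ b ∷ suf)
avoids321-unswap pre {a} {b} suf a<b avoids (x , y , z , p , y<x , z<y) with ⊆-swap pre a b suf p
... | inj₁ q = avoids (x , y , z , q , y<x , z<y)
... | inj₂ ([] , _ , refl) = <-asym a<b y<x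
... | inj₂ (_ ∷ [] , _ , refl) = <-asym a<b z<y
... | inj₂ (_ ∷ _ ∷ [] , _ , ())
... | inj₂ (_ ∷ _ ∷ _ ∷ [] , _ , ())
... | inj₂ (_ ∷ _ ∷ _ ∷ _ ∷ _ , _ , ())

rightCover-enumerates : ∀ {n v w} → RightCover n v w → Enumerates n v → Enumerates n w
rightCover-enumerates {n} {v} (i , _ , _ , refl , _) env with swapPos-cases i v
... | inj₁ eq = subst (Enumerates n) (sym eq) env
... | inj₂ (pre , a , b , suf , refl , eq) rewrite eq =
  enumerates-resp-↭ (++⁺ˡ pre (↭-swap a b ↭-refl)) env

rightCover-step : ∀ {n v w} → RightCover n v w → Enumerates n v → Avoids321 w →
  Avoids321 v × rowInsertAll w [] ⊆ₛ rowInsertAll v [] above 0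
rightCover-step {n} {v} (i , _ , _ , refl , inv<) env avoids with swapPos-cases i v
... | inj₁ eq = ⊥-elim (<-irrefl (sym (cong inv eq)) inv<)
... | inj₂ (pre , a , b , suf , refl , eq) rewrite eq =
  avoids321-unswap pre suf a<b avoids ,
  rowInsertAll-swap-adjacent pre suf a<b (distinct env) avoids
    (All.tabulate λ {e} p → proj₁ (bounded env e (∈-++⁺ʳ pre (there (there p)))))
  where
  a<b : a < b
  a<b = inv-swap⇒< pre a b suf inv<

-- The simple transposition sᵢ

≡ᵇ-reflects-≡ : ∀ m n → Reflects (m ≡ n) (m ≡ᵇ n)
≡ᵇ-reflects-≡ m n = fromEquivalence (≡ᵇ⇒≡ m n) (≡⇒≡ᵇ m n)

<ᵇ-≡ : ∀ {m n m′ n′} → (m < n → m′ < n′) → (m′ < n′ → m < n) → (m <ᵇ n) ≡ (m′ <ᵇ n′)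
<ᵇ-≡ {m} {n} {m′} {n′} f g = det (<ᵇ-reflects-< m n) (fromEquivalence (g ∘ <ᵇ⇒< m′ n′) (<⇒<ᵇ ∘ f))

data SᵢCases (i : ℕ) : ℕ → ℕ → Set where
  at-i : SᵢCases i i (suc i)
  at-suc-i : SᵢCases i (suc i) i
  elsewhere : ∀ {x} → x ≢ i → x ≢ suc i → SᵢCases i x x

sᵢ-cases : ∀ i x → SᵢCases i x (sᵢ i x)
sᵢ-cases i x with x ≡ᵇ i | ≡ᵇ-reflects-≡ x i
... | true | ofʸ refl = at-i
... | false | ofⁿ x≢i with x ≡ᵇ suc i | ≡ᵇ-reflects-≡ x (suc i)
...   | true | ofʸ refl = at-suc-i
...   | false | ofⁿ x≢1+i = elsewhere x≢i x≢1+i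

sᵢ-i : ∀ i → sᵢ i i ≡ suc i
sᵢ-i i with sᵢ i i | sᵢ-cases i i
... | _ | at-i = refl
... | _ | elsewhere i≢i _ = ⊥-elim (i≢i refl)

sᵢ-suc-i : ∀ i → sᵢ i (suc i) ≡ i
sᵢ-suc-i i with sᵢ i (suc i) | sᵢ-cases i (suc i)
... | _ | at-suc-i = refl
... | _ | elsewhere _ 1+i≢1+i = ⊥-elim (1+i≢1+i refl)

sᵢ-other : ∀ i {x} → x ≢ i → x ≢ suc i → sᵢ i x ≡ x
sᵢ-other i {x} x≢i x≢1+i with sᵢ i x | sᵢ-cases i x
... | _ | at-i = ⊥-elim (x≢i refl)
... | _ | at-suc-i = ⊥-elim (x≢1+i refl)
... | _ | elsewhere _ _ = refl

sᵢ-involutive : ∀ i x → sᵢ i (sᵢ i x) ≡ x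
sᵢ-involutive i x with sᵢ i x | sᵢ-cases i x
... | _ | at-i = sᵢ-suc-i i
... | _ | at-suc-i = sᵢ-i i
... | _ | elsewhere x≢i x≢1+i with sᵢ i x | sᵢ-cases i x
...   | _ | at-i = ⊥-elim (x≢i refl)
...   | _ | at-suc-i = ⊥-elim (x≢1+i refl)
...   | _ | elsewhere _ _ = refl

sᵢ-injective : ∀ i {x y} → sᵢ i x ≡ sᵢ i y → x ≡ y
sᵢ-injective i {x} {y} sx≡sy =
  trans (sym (sᵢ-involutive i x)) (trans (cong (sᵢ i) sx≡sy) (sᵢ-involutive i y))

sᵢ-mono : ∀ i {x y} → x < y → ¬ (x ≡ i × y ≡ suc i) → sᵢ i x < sᵢ i y
sᵢ-mono i {x} {y} x<y not-i,1+i with sᵢ i x | sᵢ-cases i x | sᵢ i y | sᵢ-cases i y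
... | _ | at-i | _ | at-i = ⊥-elim (<-irrefl refl x<y)
... | _ | at-i | _ | at-suc-i = ⊥-elim (not-i,1+i (refl , refl))
... | _ | at-i | _ | elsewhere _ y≢1+i = ≤∧≢⇒< x<y (λ eq → y≢1+i (sym eq))
... | _ | at-suc-i | _ | at-i = ⊥-elim (<-asym x<y (n<1+n i))
... | _ | at-suc-i | _ | at-suc-i = ⊥-elim (<-irrefl refl x<y)
... | _ | at-suc-i | _ | elsewhere _ _ = <-trans (n<1+n i) x<y
... | _ | elsewhere _ _ | _ | at-i = <-trans x<y (n<1+n i)
... | _ | elsewhere x≢i _ | _ | at-suc-i = ≤∧≢⇒< (s≤s⁻¹ x<y) x≢i
... | _ | elsewhere _ _ | _ | elsewhere _ _ = x<y

sᵢ-mono⁻ : ∀ i {x y} → sᵢ i x < sᵢ i y → ¬ (x ≡ suc i × y ≡ i) → x < y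
sᵢ-mono⁻ i {x} {y} sx<sy not-1+i,i =
  subst₂ _<_ (sᵢ-involutive i x) (sᵢ-involutive i y) (sᵢ-mono i sx<sy not-i,1+i)
  where
  not-i,1+i : ¬ (sᵢ i x ≡ i × sᵢ i y ≡ suc i)
  not-i,1+i (sx≡i , sy≡1+i) = not-1+i,i
    ( trans (sym (sᵢ-involutive i x)) (trans (cong (sᵢ i) sx≡i) (sᵢ-i i))
    , trans (sym (sᵢ-involutive i y)) (trans (cong (sᵢ i) sy≡1+i) (sᵢ-suc-i i)) )

PreservesOrder : (ℕ → ℕ) → ℕ → ℕ → Set
PreservesOrder f x y = (f x <ᵇ f y) ≡ (x <ᵇ y)

sᵢ-preservesOrder : ∀ i {x y} → ¬ (x ≡ i × y ≡ suc i) → ¬ (x ≡ suc i × y ≡ i) →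
  PreservesOrder (sᵢ i) x y
sᵢ-preservesOrder i not-i,1+i not-1+i,i =
  <ᵇ-≡ (λ sx<sy → sᵢ-mono⁻ i sx<sy not-1+i,i) (λ x<y → sᵢ-mono i x<y not-i,1+i)

sᵢ-preservesOrder-≢suc : ∀ i {x y} → x ≢ suc i → y ≢ suc i → PreservesOrder (sᵢ i) x y
sᵢ-preservesOrder-≢suc i x≢1+i y≢1+i =
  sᵢ-preservesOrder i (λ (_ , y≡1+i) → y≢1+i y≡1+i) (λ (x≡1+i , _) → x≢1+i x≡1+i)

sᵢ-bounded : ∀ {n i y} → 1 ≤ i → i < n → 1 ≤ y × y ≤ n → 1 ≤ sᵢ i y × sᵢ i y ≤ n
sᵢ-bounded {n} {i} {y} 1≤i i<n y-bounded with sᵢ i y | sᵢ-cases i y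
... | _ | at-i = s≤s z≤n , i<n
... | _ | at-suc-i = 1≤i , <⇒≤ i<n
... | _ | elsewhere _ _ = y-bounded

map-sᵢ-split : ∀ i pre C → All (λ c → c ≢ i × c ≢ suc i) C →
  map (sᵢ i) (pre ++ suc i ∷ C) ≡ map (sᵢ i) pre ++ i ∷ C
map-sᵢ-split i pre C C≢i,1+i = begin
  map (sᵢ i) (pre ++ suc i ∷ C)                 ≡⟨ map-++ (sᵢ i) pre (suc i ∷ C) ⟩
  map (sᵢ i) pre ++ sᵢ i (suc i) ∷ map (sᵢ i) C ≡⟨ cong₂ (λ a l → map (sᵢ i) pre ++ a ∷ l) (sᵢ-suc-i i) fixes ⟩
  map (sᵢ i) pre ++ i ∷ C                       ∎
  where
  open ≡-Reasoning
  fixes : map (sᵢ i) C ≡ C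
  fixes = map-id-local (All.map (λ (c≢i , c≢1+i) → sᵢ-other i c≢i c≢1+i) C≢i,1+i)

rowInsert-map : ∀ f x R → (∀ y → y ∈ R → PreservesOrder f x y) →
  rowInsert (f x) (map f R) ≡ (map f (proj₁ (rowInsert x R)) , Maybe.map f (proj₂ (rowInsert x R)))
rowInsert-map f x [] _ = refl
rowInsert-map f x (y ∷ ys) pres rewrite pres y (here refl) with x <ᵇ y
... | true = refl
... | false with rowInsert x ys | rowInsert-map f x ys (λ z p → pres z (there p))
...   | _ , _ | eq rewrite eq = refl

markIfJust-map : ∀ k (f : ℕ → ℕ) b → markIfJust k (Maybe.map f b) ≡ markIfJust k b
markIfJust-map k f nothing = refl
markIfJust-map k f (just _) = refl

rowInsertAll-map : ∀ f (P : ℕ → Set) → (∀ {x y} → P x → P y → PreservesOrder f x y) →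
  ∀ k u R → All P u → All P R →
  bumpTimes k (map f u) (map f R) ≡ bumpTimes k u R ×
  rowInsertAll (map f u) (map f R) ≡ map f (rowInsertAll u R)
rowInsertAll-map f P pres k [] R _ _ = refl , refl
rowInsertAll-map f P pres k (x ∷ u) R (Px ∷ Pu) PR
  rewrite rowInsert-map f x R (λ y p → pres Px (All.lookup PR p))
        | markIfJust-map k f (proj₂ (rowInsert x R))
        | proj₁ (rowInsertAll-map f P pres (suc k) u _ Pu (rowInsert-All (rowInsert-view x R) Px PR))
  = refl , proj₂ (rowInsertAll-map f P pres (suc k) u _ Pu (rowInsert-All (rowInsert-view x R) Px PR))

rowInsertAll-map-sᵢ : ∀ i k u R → All (_≢ suc i) u → All (_≢ suc i) R →
  bumpTimes k (map (sᵢ i) u) (map (sᵢ i) R) ≡ bumpTimes k u R ×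
  rowInsertAll (map (sᵢ i) u) (map (sᵢ i) R) ≡ map (sᵢ i) (rowInsertAll u R)
rowInsertAll-map-sᵢ i = rowInsertAll-map (sᵢ i) (_≢ suc i) (sᵢ-preservesOrder-≢suc i)

bit-≤ : ∀ {m n m′ n′} → (m < n → m′ < n′) → (if m <ᵇ n then 1 else 0) ≤ (if m′ <ᵇ n′ then 1 else 0)
bit-≤ {m} {n} {m′} {n′} f with m <ᵇ n | <ᵇ-reflects-< m n | m′ <ᵇ n′ | <ᵇ-reflects-< m′ n′
... | false | _ | _ | _ = z≤n
... | true | _ | true | _ = ≤-refl
... | true | ofʸ m<n | false | ofⁿ m′≮n′ = ⊥-elim (m′≮n′ (f m<n))

countGreater-map : ∀ f x xs → (∀ y → y ∈ xs → PreservesOrder f y x) →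
  countGreater (f x) (map f xs) ≡ countGreater x xs
countGreater-map f x [] _ = refl
countGreater-map f x (y ∷ ys) pres
  rewrite pres y (here refl) | countGreater-map f x ys (λ z p → pres z (there p)) = refl

inv-map : ∀ f xs → AllPairs (λ x y → PreservesOrder f y x) xs → inv (map f xs) ≡ inv xs
inv-map f [] _ = refl
inv-map f (x ∷ xs) (pres ∷ pairs)
  rewrite countGreater-map f x xs (λ y p → All.lookup pres p) | inv-map f xs pairs = refl

countGreater-map-≤ : ∀ f a b xs → (∀ y → y ∈ xs → f y < a → y < b) →
  countGreater a (map f xs) ≤ countGreater b xs
countGreater-map-≤ f a b [] _ = z≤n
countGreater-map-≤ f a b (y ∷ ys) h =
  +-mono-≤ (bit-≤ (h y (here refl))) (countGreater-map-≤ f a b ys (λ z p → h z (there p)))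

countGreater-map-< : ∀ f a b xs → (∀ y → y ∈ xs → f y < a → y < b) → ∀ {z} → z ∈ xs → f z ≮ a → z < b →
  countGreater a (map f xs) < countGreater b xs
countGreater-map-< f a b (y ∷ ys) h (there p) fz≮a z<b =
  +-mono-≤-< (bit-≤ (h y (here refl))) (countGreater-map-< f a b ys (λ z q → h z (there q)) p fz≮a z<b)
countGreater-map-< f a b (y ∷ ys) h (here refl) fy≮a y<b
  with f y <ᵇ a | <ᵇ-reflects-< (f y) a | y <ᵇ b | <ᵇ-reflects-< y b
... | true | ofʸ fy<a | _ | _ = ⊥-elim (fy≮a fy<a)
... | false | _ | false | ofⁿ y≮b = ⊥-elim (y≮b y<b)
... | false | _ | true | _ = s≤s (countGreater-map-≤ f a b ys (λ z p → h z (there p)))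

All⇒AllPairs : ∀ {P : ℕ → Set} {R : ℕ → ℕ → Set} {xs} → (∀ {x y} → P x → P y → R x y) →
  All P xs → AllPairs R xs
All⇒AllPairs r [] = []
All⇒AllPairs r (px ∷ pxs) = All.map (r px) pxs ∷ All⇒AllPairs r pxs

-- Left covers

⊆ₛ-++⁺ˡ : ∀ l {a b} → a ⊆ₛ b → (l ++ a) ⊆ₛ (l ++ b)
⊆ₛ-++⁺ˡ l a⊆b j p with ∈-++⁻ l p
... | inj₁ q = ∈-++⁺ˡ q
... | inj₂ q = ∈-++⁺ʳ l (a⊆b j q)

-- In v = pre ++ (i+1) ∷ C with i in pre, the letters of C exceed i + 1 (else s_i v has the pattern i+1, i, c),
-- s_i is an order isomorphism on pre, and the first rows before inserting i+1, resp. i, agree above i + 1.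
bumpTimes-leftCover : ∀ i pre C → i ∈ pre → All (_≢ suc i) pre → All (λ c → c ≢ i × c ≢ suc i) C →
  Unique (pre ++ suc i ∷ C) → Avoids321 (map (sᵢ i) pre ++ i ∷ C) →
  bumpTimes 1 (pre ++ suc i ∷ C) [] ⊆ₛ bumpTimes 1 (map (sᵢ i) pre ++ i ∷ C) []
bumpTimes-leftCover i pre C i∈pre pre≢1+i C≢i,1+i uniq avoids
  rewrite bumpTimes-++ 1 pre {suc i ∷ C} [] | bumpTimes-++ 1 (map (sᵢ i) pre) {i ∷ C} []
        | length-map (sᵢ i) pre
        | proj₁ (rowInsertAll-map-sᵢ i 1 pre [] pre≢1+i [])
        | proj₂ (rowInsertAll-map-sᵢ i 1 pre [] pre≢1+i []) =
  ⊆ₛ-++⁺ˡ (bumpTimes 1 pre []) (markIfJust-⊆ (suc (length pre)) (proj₂ step) (proj₁ rest))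
  where
  Rv = rowInsertAll pre []
  uniqw : Unique (map (sᵢ i) pre ++ i ∷ C)
  uniqw = subst Unique (map-sᵢ-split i pre C C≢i,1+i) (Uniqueₚ.map⁺ (sᵢ-injective i) uniq)
  admv : Admissible Rv (suc i ∷ C)
  admv = rowInsertAll-admissible pre [] (admissible-[] uniq)
  admw : Admissible (map (sᵢ i) Rv) (i ∷ C)
  admw = subst (λ R → Admissible R (i ∷ C)) (proj₂ (rowInsertAll-map-sᵢ i 1 pre [] pre≢1+i []))
           (rowInsertAll-admissible (map (sᵢ i) pre) [] (admissible-[] uniqw))
  above : Rv ⊆ₛ map (sᵢ i) Rv above suc i
  above e p 1+i<e = subst (_∈ map (sᵢ i) Rv) (sᵢ-other i e≢i e≢1+i) (∈-map⁺ (sᵢ i) p)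
    where
    e≢i : e ≢ i
    e≢i refl = <-asym 1+i<e (n<1+n i)
    e≢1+i : e ≢ suc i
    e≢1+i refl = <-irrefl refl 1+i<e
  C>1+i : All (suc i <_) C
  C>1+i = All.tabulate λ {c} p → let c≢i , c≢1+i = All.lookup C≢i,1+i p in ≰⇒> λ c≤1+i →
    avoids (suc i , i , c , ++⁺ (from∈ 1+i∈w-pre) (refl ∷ from∈ p) , n<1+n i ,
            ≤∧≢⇒< (s≤s⁻¹ (≤∧≢⇒< c≤1+i c≢1+i)) c≢i)
    where
    1+i∈w-pre : suc i ∈ map (sᵢ i) pre
    1+i∈w-pre = subst (_∈ map (sᵢ i) pre) (sᵢ-i i) (∈-map⁺ (sᵢ i) i∈pre)
  insv = rowInsert-view (suc i) Rv
  insw = rowInsert-view i (map (sᵢ i) Rv)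
  step = rowInsert-⊆above insv insw (increasing admv) (increasing admw) ≤-refl (n≤1+n i) (inj₂ refl) above
  rest = rowInsertAll-⊆above (suc i) (suc (suc (length pre))) C _ _
           (rowInsert-admissible insv admv) (rowInsert-admissible insw admw) C>1+i (proj₁ step)

-- Only the relative order of the values i and i + 1 changes.
inv-map-sᵢ-< : ∀ i v → Unique v → (suc i ∷ i ∷ []) ⊆ v → inv (map (sᵢ i) v) < inv v
inv-map-sᵢ-< i (x ∷ xs) (x∉xs ∷ uniq) (.x ∷ʳ p) =
  subst (λ c → c + inv (map (sᵢ i) xs) < countGreater x xs + inv xs) (sym unchanged)
    (+-monoʳ-< (countGreater x xs) (inv-map-sᵢ-< i xs uniq p))
  where
  x≢1+i : x ≢ suc i
  x≢1+i = All.lookup x∉xs (to∈ p)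
  x≢i : x ≢ i
  x≢i = All.lookup x∉xs (to∈ (∷ˡ⁻ p))
  unchanged : countGreater (sᵢ i x) (map (sᵢ i) xs) ≡ countGreater x xs
  unchanged = countGreater-map (sᵢ i) x xs λ y _ →
    sᵢ-preservesOrder i (λ (_ , x≡1+i) → x≢1+i x≡1+i) (λ (_ , x≡i) → x≢i x≡i)
inv-map-sᵢ-< i (.(suc i) ∷ xs) (1+i∉xs ∷ uniq) (refl ∷ p)
  rewrite sᵢ-suc-i i
        | inv-map (sᵢ i) xs (All⇒AllPairs (λ x≢ y≢ → sᵢ-preservesOrder-≢suc i y≢ x≢)
                                         (All.map (λ ne eq → ne (sym eq)) 1+i∉xs)) =
  +-monoˡ-< (inv xs) (countGreater-map-< (sᵢ i) i (suc i) xs below (to∈ p)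
    (λ si<i → <-asym si<i (subst (i <_) (sym (sᵢ-i i)) (n<1+n i))) (n<1+n i))
  where
  below : ∀ y → y ∈ xs → sᵢ i y < i → y < suc i
  below y _ sy<i =
    sᵢ-mono⁻ i (subst (sᵢ i y <_) (sym (sᵢ-suc-i i)) sy<i) (λ (_ , 1+i≡i) → <-irrefl (sym 1+i≡i) (n<1+n i))

∈-pair-ordered : ∀ {a b : ℕ} {v} → a ∈ v → b ∈ v → a ≢ b → (a ∷ b ∷ []) ⊆ v ⊎ (b ∷ a ∷ []) ⊆ v
∈-pair-ordered (here refl) (here refl) a≢b = ⊥-elim (a≢b refl)
∈-pair-ordered (here refl) (there q) _ = inj₁ (refl ∷ from∈ q)
∈-pair-ordered (there p) (here refl) _ = inj₂ (refl ∷ from∈ p)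
∈-pair-ordered {v = x ∷ v} (there p) (there q) a≢b with ∈-pair-ordered p q a≢b
... | inj₁ r = inj₁ (x ∷ʳ r)
... | inj₂ r = inj₂ (x ∷ʳ r)

⊆-pair-antisym : ∀ {a b : ℕ} {v} → Unique v → (a ∷ b ∷ []) ⊆ v → (b ∷ a ∷ []) ⊆ v → a ≡ b
⊆-pair-antisym (_ ∷ uniq) (x ∷ʳ p) (.x ∷ʳ q) = ⊆-pair-antisym uniq p q
⊆-pair-antisym (x∉ ∷ _) (_ ∷ʳ p) (refl ∷ q) = ⊥-elim (All.lookup x∉ (to∈ (∷ˡ⁻ p)) refl)
⊆-pair-antisym (x∉ ∷ _) (refl ∷ p) (_ ∷ʳ q) = ⊥-elim (All.lookup x∉ (to∈ (∷ˡ⁻ q)) refl)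
⊆-pair-antisym _ (refl ∷ _) (refl ∷ _) = refl

⊆-pair-split : ∀ {a b : ℕ} {v} → (a ∷ b ∷ []) ⊆ v → ∃[ pre ] ∃[ C ] (v ≡ pre ++ b ∷ C × a ∈ pre)
⊆-pair-split (x ∷ʳ p) with ⊆-pair-split p
... | pre , C , refl , a∈pre = x ∷ pre , C , refl , there a∈pre
⊆-pair-split (refl ∷ p) with ∈-∃++ (to∈ p)
... | pre , C , refl = _ ∷ pre , C , refl , here refl

unique-++∷⁻ : ∀ pre {m : ℕ} {C} → Unique (pre ++ m ∷ C) → m ∉ pre × m ∉ C × Disjoint pre C
unique-++∷⁻ [] (m∉C ∷ _) = (λ ()) , (λ p → All.lookup m∉C p refl) , (λ { (() , _) })
unique-++∷⁻ (x ∷ pre) {m} {C} (x∉ ∷ uniq) with unique-++∷⁻ pre uniq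
... | m∉pre , m∉C , disj = m∉x∷pre , m∉C , disj′
  where
  m∉x∷pre : m ∉ x ∷ pre
  m∉x∷pre (here refl) = All.lookup x∉ (∈-insert pre) refl
  m∉x∷pre (there p) = m∉pre p
  disj′ : Disjoint (x ∷ pre) C
  disj′ (here refl , q) = All.lookup x∉ (∈-++∷⁺ʳ pre q) refl
  disj′ (there p , q) = disj (p , q)

-- The one pair of values whose order s_i reverses occurs in v in increasing order.
map-sᵢ-keeps-inversions : ∀ i {v} → Unique v → (i ∷ suc i ∷ []) ⊆ v →
  ∀ {x y} → (x ∷ y ∷ []) ⊆ v → y < x → sᵢ i y < sᵢ i x
map-sᵢ-keeps-inversions i uniq i,1+i x,y y<x =
  sᵢ-mono i y<x λ { (refl , refl) → <-irrefl (⊆-pair-antisym uniq i,1+i x,y) (n<1+n i) }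

avoids321-map-sᵢ⁻ : ∀ i {v} → Unique v → (i ∷ suc i ∷ []) ⊆ v → Avoids321 (map (sᵢ i) v) → Avoids321 v
avoids321-map-sᵢ⁻ i uniq i,1+i avoids (x , y , z , p , y<x , z<y) =
  avoids (sᵢ i x , sᵢ i y , sᵢ i z , Sublist.map⁺ (sᵢ i) p ,
          map-sᵢ-keeps-inversions i uniq i,1+i (⊆-trans (refl ∷ refl ∷ z ∷ʳ []) p) y<x ,
          map-sᵢ-keeps-inversions i uniq i,1+i (⊆-trans (x ∷ʳ refl ∷ refl ∷ []) p) z<y)

enumerates-map-sᵢ : ∀ {n i v} → 1 ≤ i → i < n → Enumerates n v → Enumerates n (map (sᵢ i) v)
enumerates-map-sᵢ {n} {i} {v} 1≤i i<n env = record
  { distinct = Uniqueₚ.map⁺ (sᵢ-injective i) (distinct env)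
  ; bounded = bounded′
  ; complete = λ x 1≤x x≤n → subst (_∈ map (sᵢ i) v) (sᵢ-involutive i x)
      (∈-map⁺ (sᵢ i) (uncurry (complete env (sᵢ i x)) (sᵢ-bounded 1≤i i<n (1≤x , x≤n)))) }
  where
  bounded′ : ∀ x → x ∈ map (sᵢ i) v → 1 ≤ x × x ≤ n
  bounded′ x p with ∈-map⁻ (sᵢ i) p
  ... | y , q , refl = sᵢ-bounded 1≤i i<n (bounded env y q)

leftCover-enumerates : ∀ {n v w} → LeftCover n v w → Enumerates n v → Enumerates n w
leftCover-enumerates (i , 1≤i , i<n , refl , _) = enumerates-map-sᵢ 1≤i i<n

leftCover-step : ∀ {n v w} → LeftCover n v w → Enumerates n v → Avoids321 w →
  Avoids321 v × bumpTimes 1 v [] ⊆ₛ bumpTimes 1 w []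
leftCover-step {n} {v} (i , 1≤i , i<n , refl , inv<) env avoids
  with ∈-pair-ordered (complete env i 1≤i (<⇒≤ i<n)) (complete env (suc i) (s≤s z≤n) i<n)
                      (λ i≡1+i → <-irrefl i≡1+i (n<1+n i))
... | inj₂ 1+i,i = ⊥-elim (<-asym inv< (inv-map-sᵢ-< i v (distinct env) 1+i,i))
... | inj₁ i,1+i with ⊆-pair-split i,1+i
...   | pre , C , refl , i∈pre with unique-++∷⁻ pre (distinct env)
...     | 1+i∉pre , 1+i∉C , disj =
  avoids321-map-sᵢ⁻ i (distinct env) i,1+i avoids ,
  subst (λ w → bumpTimes 1 (pre ++ suc i ∷ C) [] ⊆ₛ bumpTimes 1 w []) (sym split)
    (bumpTimes-leftCover i pre C i∈pre (All.tabulate λ p eq → 1+i∉pre (subst (_∈ pre) eq p))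
       C≢i,1+i (distinct env) (subst Avoids321 split avoids))
  where
  C≢i,1+i : All (λ c → c ≢ i × c ≢ suc i) C
  C≢i,1+i = All.tabulate λ p → (λ { refl → disj (i∈pre , p) }) , (λ { refl → 1+i∉C p })
  split = map-sᵢ-split i pre C C≢i,1+i

-- Chains in the weak orders

transClosure-lift : ∀ {A : Set} {_⋖_ _≼_ : A → A → Set} {P Q : A → Set} →
  (∀ {x y z} → x ≼ y → y ≼ z → x ≼ z) → (∀ {v w} → v ⋖ w → P v → P w) →
  (∀ {v w} → v ⋖ w → P v → Q w → Q v × v ≼ w) →
  ∀ {v w} → TransClosure _⋖_ v w → P v → Q w → Q v × v ≼ w
transClosure-lift ≼-trans up step [ v⋖w ]⁺ pv qw = step v⋖w pv qw
transClosure-lift ≼-trans up step (v⋖y ∷⁺ y⋯w) pv qw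
  with transClosure-lift ≼-trans up step y⋯w (up v⋖y pv) qw
... | qy , y≼w with step v⋖y pv qy
...   | qv , v≼y = qv , ≼-trans v≼y y≼w

corollary3p7 : (n : ℕ) (v w : List ℕ) → IsPerm n v → IsPerm n w → Avoids321 v → Avoids321 w → (RightWeakLt n v w → Row₂ (Pt v) ⊆ₛ Row₂ (Pt w)) × (LeftWeakLt n v w → Row₂ (Qt v) ⊆ₛ Row₂ (Qt w))
corollary3p7 n v w v-perm w-perm v-avoids w-avoids = right , left
  where
  env = isPerm⇒enumerates v-perm
  enw = isPerm⇒enumerates w-perm
  rskv = Row₂-rsk v (distinct env) v-avoids
  rskw = Row₂-rsk w (distinct enw) w-avoids
  right : RightWeakLt n v w → Row₂ (Pt v) ⊆ₛ Row₂ (Pt w)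
  right v<w rewrite proj₁ rskv | proj₁ rskw =
    bumpedOut-mono v w env enw (proj₂ (transClosure-lift (λ v≼y y≼w → ⊆ₛ-above-trans y≼w v≼y)
      rightCover-enumerates rightCover-step v<w env w-avoids))
  left : LeftWeakLt n v w → Row₂ (Qt v) ⊆ₛ Row₂ (Qt w)
  left v<w rewrite proj₂ rskv | proj₂ rskw =
    proj₂ (transClosure-lift (λ v≼y y≼w e p → y≼w e (v≼y e p))
      leftCover-enumerates leftCover-step v<w env w-avoids)
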